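{- Let $G$ be a claw-$o$-heavy graph, and let $x$ be a $c$-eligible vertex of $G$. If $G'$ is a spanning supergraph of $G$ that contains no induced diamond and has no $o$-heavy pair (with respect to $G'$), then $G^o_x\subseteq G'$.
   Context: All graphs are finite and simple. For a graph $G$ on $n$ vertices, $d(v)$ and $N(v)$ are degree and neighborhood in $G$. A pair $\{u,v\}$ of nonadjacent vertices of $G$ is an $o$-heavy pair of $G$ if $d(u)+d(v)\ge n$. $G$ is claw-$o$-heavy if every induced subgraph isomorphic to $K_{1,3}$ contains an $o$-heavy pair of $G$. The diamond $D$ is $K_4$ minus an edge. For $x\in V(G)$, let $E^{BC}_x=\{uv: u,v\in N(x), uv\notin E(G), d(u)+d(v)\ge n\}$ and $G^{BC}_x=(V(G),E(G)\cup E^{BC}_x)$. The vertex $x$ is $c$-eligible if $N(x)$ is not a clique in $G^{BC}_x$ and either (i) $G^{BC}_x[N(x)]$ is connected, or (ii) $G^{BC}_x[N(x)]$ is the disjoint union of two cliques $C_1,C_2$ and there is a vertex $z$ with $\{x,z\}$ an $o$-heavy pair of $G$ and $zy_1,zy_2\in E(G)$ for some $y_1\in C_1,y_2\in C_2$. The local $c$-completion $G^o_x$ is the graph with vertex set $V(G)$ and edge set $E(G)\cup\{uv: u,v\in N(x), uv\notin E(G)\}$. -}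

module Defs where

open import Data.Nat using (ℕ; _+_; _≥_)
open import Data.Fin using (Fin)
open import Data.Bool using (Bool; true; false; if_then_else_)
open import Data.List using (List; map; allFin)
open import Data.Nat.ListAction using (sum)
open import Data.Product using (_×_; Σ; ∃; ∃-syntax; _,_)
open import Data.Sum using (_⊎_)
open import Relation.Nullary using (¬_)
open import Relation.Binary.PropositionalEquality using (_≡_; _≢_)
open import Relation.Binary.Construct.Closure.ReflexiveTransitive using (Star)

record Graph (n : ℕ) : Set where
  field
    adj    : Fin n → Fin n → Bool
    adj-sym : ∀ u v → adj u v ≡ adj v u
    adj-irr : ∀ v → adj v v ≡ false

open Graph public

module _ {n : ℕ} (G : Graph n) where

  Edge : Fin n → Fin n → Set
  Edge u v = adj G u v ≡ true

  deg : Fin n → ℕ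
  deg v = sum (map (λ w → if adj G v w then 1 else 0) (allFin n))

  OHeavy : Fin n → Fin n → Set
  OHeavy u v = u ≢ v × ¬ Edge u v × deg u + deg v ≥ n

  InducedClaw : Fin n → Fin n → Fin n → Fin n → Set
  InducedClaw c a b d =
    a ≢ b × a ≢ d × b ≢ d ×
    Edge c a × Edge c b × Edge c d ×
    ¬ Edge a b × ¬ Edge a d × ¬ Edge b d

  -- every induced claw contains an o-heavy pair (only leaf pairs are nonadjacent)
  ClawOHeavy : Set
  ClawOHeavy = ∀ c a b d → InducedClaw c a b d →
    OHeavy a b ⊎ OHeavy a d ⊎ OHeavy b d

  InducedDiamond : Fin n → Fin n → Fin n → Fin n → Set
  InducedDiamond a b c d =
    a ≢ b × a ≢ c × a ≢ d × b ≢ c × b ≢ d × c ≢ d ×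
    Edge a b × Edge a c × Edge a d × Edge b c × Edge b d × ¬ Edge c d

  DiamondFree : Set
  DiamondFree = ∀ a b c d → ¬ InducedDiamond a b c d

  NoOHeavyPair : Set
  NoOHeavyPair = ∀ u v → ¬ OHeavy u v

  EdgeBC : Fin n → Fin n → Fin n → Set
  EdgeBC x u v = Edge u v ⊎ (Edge x u × Edge x v × u ≢ v × ¬ Edge u v × deg u + deg v ≥ n)

  EdgeBCin : Fin n → Fin n → Fin n → Set
  EdgeBCin x u v = Edge x u × Edge x v × EdgeBC x u v

  NbhdCliqueBC : Fin n → Set
  NbhdCliqueBC x = ∀ u v → Edge x u → Edge x v → u ≢ v → EdgeBC x u v

  -- G^BC_x[N(x)] is connected (N(x) nonempty follows from it not being a clique)
  NbhdConnectedBC : Fin n → Set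
  NbhdConnectedBC x = ∀ u v → Edge x u → Edge x v → Star (EdgeBCin x) u v

  -- G^BC_x[N(x)] is the disjoint union of two cliques C1 = {side = true}, C2 = {side = false}
  -- (within N(x)), and condition (ii) of c-eligibility holds.
  TwoCliquesCond : Fin n → Set
  TwoCliquesCond x = Σ (Fin n → Bool) λ side →
    (∀ u v → Edge x u → Edge x v → u ≢ v → side u ≡ side v → EdgeBC x u v) ×
    (∀ u v → Edge x u → Edge x v → side u ≢ side v → ¬ EdgeBC x u v) ×
    (∃[ z ] ∃[ y₁ ] ∃[ y₂ ]
       OHeavy x z ×
       Edge x y₁ × side y₁ ≡ true × Edge x y₂ × side y₂ ≡ false ×
       Edge z y₁ × Edge z y₂)

  CEligible : Fin n → Set
  CEligible x = ¬ NbhdCliqueBC x × (NbhdConnectedBC x ⊎ TwoCliquesCond x)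

  EdgeO : Fin n → Fin n → Fin n → Set
  EdgeO x u v = Edge u v ⊎ (Edge x u × Edge x v × u ≢ v)

_⊆G_ : ∀ {n} → Graph n → Graph n → Set
H ⊆G H' = ∀ u v → Edge H u v → Edge H' u v

-- Once G ⊆ G' and G' has no o-heavy pair, every edge of G^BC_x lies in G'.
-- If G' is also diamond-free, two G'-adjacent neighbours a, b of x together
-- with a common neighbour c ∈ N(x) of b force ac ∈ E(G') (else x, b, a, c span
-- a diamond), so every connected subset of G'[N_{G'}(x)] is a clique.  It thus
-- suffices that N_G(x) is connected in G'[N_{G'}(x)]: in case (i) because
-- G^BC_x ⊆ G', in case (ii) because z ∈ N_{G'}(x) joins the two cliques.
module Submission where

open import Defs
open import Data.Nat using (ℕ; _+_; _≤_; _≥_; z≤n)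
open import Data.Nat.Properties using (≤-refl; ≤-trans; +-mono-≤)
open import Data.Fin using (Fin)
import Data.Fin as Fin
open import Data.Bool using (Bool; true; false; if_then_else_)
import Data.Bool as Bool
open import Data.List using (List; []; _∷_; map; allFin)
open import Data.Nat.ListAction using (sum)
open import Data.Product using (_×_; _,_)
open import Data.Sum using (_⊎_; inj₁; inj₂; map₂)
open import Data.Empty using (⊥-elim)
open import Relation.Nullary using (yes; no)
open import Relation.Binary.PropositionalEquality
  using (_≡_; _≢_; refl; sym; trans)
open import Relation.Binary.Construct.Closure.ReflexiveTransitive
  using (Star; ε; _◅_; _◅◅_; reverse)
  renaming (map to mapStar)

sum-map-mono : ∀ {A : Set} (f g : A → ℕ) → (∀ a → f a ≤ g a) →
               ∀ (as : List A) → sum (map f as) ≤ sum (map g as)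
sum-map-mono f g f≤g []       = z≤n
sum-map-mono f g f≤g (a ∷ as) = +-mono-≤ (f≤g a) (sum-map-mono f g f≤g as)

indicator-mono : ∀ {b b′ : Bool} → (b ≡ true → b′ ≡ true) →
                 (if b then 1 else 0) ≤ (if b′ then 1 else 0)
indicator-mono {false} _ = z≤n
indicator-mono {true}  b⇒b′ rewrite b⇒b′ refl = ≤-refl

module _ {n : ℕ} (H : Graph n) where

  edge-sym : ∀ {a b} → Edge H a b → Edge H b a
  edge-sym {a} {b} = trans (adj-sym H b a)

  edge⇒≢ : ∀ {a b} → Edge H a b → a ≢ b
  edge⇒≢ {a} ab refl with () ← trans (sym ab) (adj-irr H a)

  NbhdEdge : Fin n → Fin n → Fin n → Set
  NbhdEdge x a b = Edge H x a × Edge H x b × Edge H a b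

  nbhdEdge-sym : ∀ {x a b} → NbhdEdge x a b → NbhdEdge x b a
  nbhdEdge-sym (xa , xb , ab) = xb , xa , edge-sym ab

  diamondFree-nbhd-trans : DiamondFree H → ∀ {x a b c} →
    NbhdEdge x a b → NbhdEdge x b c → a ≡ c ⊎ Edge H a c
  diamondFree-nbhd-trans df {x} {a} {b} {c} (xa , xb , ab) (_ , xc , bc)
    with a Fin.≟ c | adj H a c Bool.≟ true
  ... | yes a≡c | _      = inj₁ a≡c
  ... | no _    | yes ac = inj₂ ac
  ... | no a≢c  | no ¬ac = ⊥-elim (df x b a c
        ( edge⇒≢ xb , edge⇒≢ xa , edge⇒≢ xc , edge⇒≢ (edge-sym ab) , edge⇒≢ bc , a≢c
        , xb , xa , xc , edge-sym ab , bc , ¬ac ))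

  diamondFree-star-nbhdEdge : DiamondFree H → ∀ {x u v} →
    Star (NbhdEdge x) u v → u ≡ v ⊎ NbhdEdge x u v
  diamondFree-star-nbhdEdge df ε = inj₁ refl
  diamondFree-star-nbhdEdge df (uw@(xu , _ , _) ◅ wv*)
    with diamondFree-star-nbhdEdge df wv*
  ... | inj₁ refl = inj₂ uw
  ... | inj₂ wv@(_ , xv , _) = map₂ (λ uv → xu , xv , uv) (diamondFree-nbhd-trans df uw wv)

module _ {n : ℕ} {G G' : Graph n} (G⊆G' : G ⊆G G') where

  deg-mono : ∀ v → deg G v ≤ deg G' v
  deg-mono v = sum-map-mono _ _ (λ w → indicator-mono (G⊆G' v w)) (allFin n)

  module _ (noHeavy : NoOHeavyPair G') where

    heavy⇒edge : ∀ {u v} → u ≢ v → deg G u + deg G v ≥ n → Edge G' u v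
    heavy⇒edge {u} {v} u≢v heavy with adj G' u v Bool.≟ true
    ... | yes uv = uv
    ... | no ¬uv = ⊥-elim (noHeavy u v
          (u≢v , ¬uv , ≤-trans heavy (+-mono-≤ (deg-mono u) (deg-mono v))))

    edgeBC⇒edge : ∀ {x u v} → EdgeBC G x u v → Edge G' u v
    edgeBC⇒edge {u = u} {v} (inj₁ uv)                        = G⊆G' u v uv
    edgeBC⇒edge             (inj₂ (_ , _ , u≢v , _ , heavy)) = heavy⇒edge u≢v heavy

    edgeBCin⇒nbhdEdge : ∀ {x u v} → EdgeBCin G x u v → NbhdEdge G' x u v
    edgeBCin⇒nbhdEdge {x} {u} {v} (xu , xv , uv) =
      G⊆G' x u xu , G⊆G' x v xv , edgeBC⇒edge uv

    twoCliques⇒nbhd-connected : ∀ {x} → TwoCliquesCond G x →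
      ∀ {u v} → Edge G x u → Edge G x v → Star (NbhdEdge G' x) u v
    twoCliques⇒nbhd-connected {x}
      (side , same , _ , z , y₁ , y₂ , (x≢z , _ , heavy) , xy₁ , s₁ , xy₂ , s₂ , zy₁ , zy₂)
      xu xv = reverse (nbhdEdge-sym G') (from-y₁ xu) ◅◅ from-y₁ xv
      where
        xz : Edge G' x z
        xz = heavy⇒edge x≢z heavy

        y₁⇝y₂ : Star (NbhdEdge G' x) y₁ y₂
        y₁⇝y₂ = (G⊆G' x y₁ xy₁ , xz , edge-sym G' (G⊆G' z y₁ zy₁))
              ◅ (xz , G⊆G' x y₂ xy₂ , G⊆G' z y₂ zy₂) ◅ ε

        within-clique : ∀ {y w} → Edge G x y → Edge G x w → side y ≡ side w →
                        Star (NbhdEdge G' x) y w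
        within-clique {y} {w} xy xw sy≡sw with y Fin.≟ w
        ... | yes refl = ε
        ... | no y≢w   = edgeBCin⇒nbhdEdge (xy , xw , same y w xy xw y≢w sy≡sw) ◅ ε

        from-y₁ : ∀ {w} → Edge G x w → Star (NbhdEdge G' x) y₁ w
        from-y₁ {w} xw with side w in sw
        ... | true  = within-clique xy₁ xw (trans s₁ (sym sw))
        ... | false = y₁⇝y₂ ◅◅ within-clique xy₂ xw (trans s₂ (sym sw))

    eligible⇒nbhd-connected : ∀ {x} → CEligible G x →
      ∀ {u v} → Edge G x u → Edge G x v → Star (NbhdEdge G' x) u v
    eligible⇒nbhd-connected (_ , inj₁ connected) xu xv =
      mapStar edgeBCin⇒nbhdEdge (connected _ _ xu xv)
    eligible⇒nbhd-connected (_ , inj₂ twoCliques) =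
      twoCliques⇒nbhd-connected twoCliques

lemma3 : ∀ {n : ℕ} (G G' : Graph n) (x : Fin n) →
    ClawOHeavy G → CEligible G x →
    G ⊆G G' → DiamondFree G' → NoOHeavyPair G' →
    ∀ u v → EdgeO G x u v → Edge G' u v
lemma3 G G' x _ eligible G⊆G' diamondFree noHeavy u v (inj₁ uv) = G⊆G' u v uv
lemma3 G G' x _ eligible G⊆G' diamondFree noHeavy u v (inj₂ (xu , xv , u≢v))
  with diamondFree-star-nbhdEdge G' diamondFree
         (eligible⇒nbhd-connected {G = G} {G' = G'} G⊆G' noHeavy {x} eligible xu xv)
... | inj₁ u≡v          = ⊥-elim (u≢v u≡v)
... | inj₂ (_ , _ , uv) = uv
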